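{- Let $k,l\ge1$ and $1\le r\le 2k(2l+1)$. Let $\overline{\mathcal{B}}(2k,2l+1;r)$ be the set of boards in $\mathcal{B}(2k,2l+1;r)$ whose board partition $(\lambda_1,\lambda_2,\lambda_3,\lambda_4,\delta_1,\delta_2)$ satisfies: (i) $\lambda_1\ge\lambda_i$ for all $i>1$; (ii) if $\lambda_1=\lambda_2$ then $\lambda_3\ge\lambda_4$; (iii) if $\lambda_1=\lambda_3$ then $\lambda_2\ge\lambda_4$; if in addition $\lambda_2=\lambda_4$ then $\delta_1\ge\delta_2$; (iv) if $\lambda_1=\lambda_4$ then $\lambda_2\ge\lambda_3$; if in addition $\lambda_2=\lambda_3$ then $\delta_1\ge\delta_2$. Then: (1) $\overline{\mathcal{B}}(2k,2l+1;r)$ is the disjoint union of the sets of all boards of $\mathcal{B}(2k,2l+1;r)$ having a given board partition, over finitely many board partitions; (2) every board in $\mathcal{B}(2k,2l+1;r)$ is equivalent under $G=\{R_0,H,V,R_{180}\}$ to some board in $\overline{\mathcal{B}}(2k,2l+1;r)$; (3) any two boards in $\overline{\mathcal{B}}(2k,2l+1;r)$ equivalent under $G$ have the same board partition.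
   Context: A $2k\times(2l+1)$ grid has cells $(i,j)$, $1\le i\le 2k$ (row from top), $1\le j\le 2l+1$ (column from left). $\mathcal{B}(2k,2l+1;r)$ is the set of all choices of exactly $r$ blocked cells. $G=\{R_0,H,V,R_{180}\}$ acts by identity, reflection across the horizontal midline ($(i,j)\mapsto(2k+1-i,j)$), reflection across the vertical midline ($(i,j)\mapsto(i,2l+2-j)$), and rotation by 180 degrees. Boards are equivalent if one is an image of the other. The board partition $(\lambda_1,\lambda_2,\lambda_3,\lambda_4,\delta_1,\delta_2)$ gives the numbers of blocked cells in: upper-left (rows $1..k$, columns $1..l$), upper-right (rows $1..k$, columns $l+2..2l+1$), lower-right (rows $k+1..2k$, columns $l+2..2l+1$), lower-left (rows $k+1..2k$, columns $1..l$), upper middle strip (rows $1..k$, column $l+1$), lower middle strip (rows $k+1..2k$, column $l+1$), respectively. -}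

module Defs where

open import Data.Nat using (ℕ; zero; suc; _+_; _*_; _≤_; _≥_; _<ᵇ_; _≡ᵇ_)
open import Data.Bool using (Bool; true; false; _∧_; if_then_else_)
open import Data.Fin using (Fin; toℕ; opposite)
open import Data.List using (List; map; allFin)
open import Data.Nat.ListAction using (sum)
open import Data.Product using (_×_; ∃)
open import Relation.Binary.PropositionalEquality using (_≡_)

-- A board on the (2k) × (2l+1) grid: b i j = true iff cell (i,j) is blocked.
-- Rows/columns are 0-based: row i ∈ {0..2k-1} (top to bottom), column j ∈ {0..2l}.
record Board (k l : ℕ) : Set where
  constructor board
  field
    cell : Fin (2 * k) → Fin (suc (2 * l)) → Bool
open Board public

countIn : ∀ {k l} → Board k l → (ℕ → ℕ → Bool) → ℕ
countIn {k} {l} b P =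
  sum (map (λ i → sum (map (λ j → if cell b i j ∧ P (toℕ i) (toℕ j) then 1 else 0)
                           (allFin (suc (2 * l)))))
           (allFin (2 * k)))

blocked : ∀ {k l} → Board k l → ℕ
blocked b = countIn b (λ _ _ → true)

InB : ∀ {k l} → ℕ → Board k l → Set
InB r b = blocked b ≡ r

record Partition : Set where
  constructor part
  field
    λ₁ λ₂ λ₃ λ₄ δ₁ δ₂ : ℕ
open Partition public

-- board partition (λ1,λ2,λ3,λ4,δ1,δ2)
-- upper: row < k ; lower: row ≥ k ; left: col < l ; middle: col = l ; right: col > l
partitionOf : ∀ {k l} → Board k l → Partition
partitionOf {k} {l} b = part
  (countIn b (λ i j → (i <ᵇ k) ∧ (j <ᵇ l)))
  (countIn b (λ i j → (i <ᵇ k) ∧ (l <ᵇ j)))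
  (countIn b (λ i j → (k <ᵇ suc i) ∧ (l <ᵇ j)))
  (countIn b (λ i j → (k <ᵇ suc i) ∧ (j <ᵇ l)))
  (countIn b (λ i j → (i <ᵇ k) ∧ (j ≡ᵇ l)))
  (countIn b (λ i j → (k <ᵇ suc i) ∧ (j ≡ᵇ l)))

Canonical : Partition → Set
Canonical (part a₁ a₂ a₃ a₄ d₁ d₂) =
  (a₁ ≥ a₂ × a₁ ≥ a₃ × a₁ ≥ a₄)
  × (a₁ ≡ a₂ → a₃ ≥ a₄)
  × (a₁ ≡ a₃ → a₂ ≥ a₄ × (a₂ ≡ a₄ → d₁ ≥ d₂))
  × (a₁ ≡ a₄ → a₂ ≥ a₃ × (a₂ ≡ a₃ → d₁ ≥ d₂))

InBbar : ∀ {k l} → ℕ → Board k l → Set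
InBbar r b = InB r b × Canonical (partitionOf b)

data Sym : Set where
  R0 H V R180 : Sym

act : ∀ {k l} → Sym → Board k l → Board k l
act R0   b = board λ i j → cell b i j
act H    b = board λ i j → cell b (opposite i) j
act V    b = board λ i j → cell b i (opposite j)
act R180 b = board λ i j → cell b (opposite i) (opposite j)

Equiv : ∀ {k l} → Board k l → Board k l → Set
Equiv b b' = ∃ λ g → ∀ i j → cell (act g b) i j ≡ cell b' i j

{-# OPTIONS --safe #-}
-- A symmetry g of the board permutes the six counts of its partition (partitionOf-act),
-- and conditions (i)-(iv) say precisely that (λ₁, λ₂, λ₃, λ₄, δ₁, δ₂) is lexicographically
-- largest among its images under G.  So the lexicographic maximum of an orbit is a
-- canonical representative, and two canonical partitions in one orbit coincide by
-- antisymmetry of the lexicographic order.  Finiteness holds because every count is at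
-- most r.
module Submission where

open import Defs
open import Data.Nat using (ℕ; _≤_; _*_; _+_; suc)
open import Data.Product using (_×_; Σ; ∃; _,_)
open import Data.List using (List)
open import Data.List.Membership.Propositional using (_∈_)
open import Function.Bundles using (_⇔_)
open import Relation.Binary.PropositionalEquality using (_≡_)

open import Data.Bool using (Bool; true; false; _∧_; if_then_else_)
open import Data.Fin as Fin using (Fin; toℕ; opposite)
open import Data.Fin.Permutation using () renaming (reverse to reversePerm)
open import Data.Fin.Properties using (opposite-prop; opposite-involutive; toℕ<n)
open import Data.List using ([]; _∷_; map; allFin; tabulate; filter; upTo; cartesianProduct)
open import Data.List.Properties using (map-tabulate; map-cong)
open import Data.List.Membership.Propositional.Properties
  using (∈-filter⁺; ∈-filter⁻; ∈-map⁺; ∈-upTo⁺; ∈-cartesianProduct⁺)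
open import Data.List.Relation.Binary.Lex.Core using (base; this; next)
import Data.List.Relation.Binary.Lex.NonStrict as Lex
open import Data.List.Relation.Binary.Pointwise using (Pointwise-≡⇒≡)
open import Data.List.Relation.Unary.All using (All; []; _∷_; lookup; universal)
open import Data.List.Relation.Unary.All.Properties using (map⁺)
open import Data.List.Relation.Unary.Any using (here; there)
open import Data.Nat using (zero; _<_; _<ᵇ_; _≡ᵇ_; z≤n; s≤s)
open import Data.Nat.ListAction using (sum)
open import Data.Nat.Properties
open import Algebra.Properties.CommutativeMonoid.Sum +-0-commutativeMonoid
  using (sum-permute) renaming (sum to ∑)
open import Data.Product using (proj₂)
open import Data.Unit using (tt)
open import Function using (_∘_; id; const; mk⇔)
open import Relation.Binary using (DecTotalOrder)
open import Relation.Nullary using (Dec; yes; no; contradiction)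
open import Relation.Nullary.Decidable using (does-⇔; _×-dec_; _→-dec_)
open import Relation.Binary.PropositionalEquality using (refl; sym; trans; cong; cong₂; subst; module ≡-Reasoning)

sum-allFin : ∀ {n} (f : Fin n → ℕ) → sum (map f (allFin n)) ≡ ∑ f
sum-allFin f = trans (cong sum (map-tabulate id f)) (sum-tabulate f)
  where
  sum-tabulate : ∀ {n} (f : Fin n → ℕ) → sum (tabulate f) ≡ ∑ f
  sum-tabulate {zero}  f = refl
  sum-tabulate {suc n} f = cong (f Fin.zero +_) (sum-tabulate (f ∘ Fin.suc))

sum-allFin-cong : ∀ n {f g : Fin n → ℕ} → (∀ i → f i ≡ g i) →
                  sum (map f (allFin n)) ≡ sum (map g (allFin n))
sum-allFin-cong n f≗g = cong sum (map-cong f≗g (allFin n))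

sum-allFin-opposite : ∀ n (f : Fin n → ℕ) →
                      sum (map f (allFin n)) ≡ sum (map (f ∘ opposite) (allFin n))
sum-allFin-opposite n f = begin
  sum (map f (allFin _))             ≡⟨ sum-allFin f ⟩
  ∑ f                                ≡⟨ sum-permute f reversePerm ⟩
  ∑ (f ∘ opposite)                   ≡⟨ sum-allFin (f ∘ opposite) ⟨
  sum (map (f ∘ opposite) (allFin _)) ∎
  where open ≡-Reasoning

sum-map-mono-≤ : ∀ {A : Set} (xs : List A) {f g : A → ℕ} → (∀ x → f x ≤ g x) →
                 sum (map f xs) ≤ sum (map g xs)
sum-map-mono-≤ []       f≤g = z≤n
sum-map-mono-≤ (x ∷ xs) f≤g = +-mono-≤ (f≤g x) (sum-map-mono-≤ xs f≤g)

<-+-swap : ∀ {a b c d} → a + b ≡ c + d → a < c → d < b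
<-+-swap {a} {b} {c} {d} eq a<c = +-cancelˡ-< c d b (begin-strict
  c + d ≡⟨ eq ⟨
  a + b <⟨ +-monoˡ-< b a<c ⟩
  c + b ∎)
  where open ≤-Reasoning

<ᵇ-swap : ∀ a b c d → a + b ≡ c + d → (a <ᵇ c) ≡ (d <ᵇ b)
<ᵇ-swap a b c d eq = does-⇔ (mk⇔ (<-+-swap eq) (<-+-swap eq′)) (a <? c) (d <? b)
  where
  eq′ : d + c ≡ b + a
  eq′ = trans (+-comm d c) (trans (sym eq) (+-comm a b))

≡ᵇ-swap : ∀ a b c d → a + b ≡ c + d → (a ≡ᵇ c) ≡ (b ≡ᵇ d)
≡ᵇ-swap a b c d eq = does-⇔ (mk⇔ (λ { refl → +-cancelˡ-≡ a b d eq })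
                                  (λ { refl → +-cancelʳ-≡ b a c eq }))
                             (a ≟ c) (b ≟ d)

toℕ-opposite-+-suc : ∀ {n} (i : Fin n) → toℕ (opposite i) + suc (toℕ i) ≡ n
toℕ-opposite-+-suc {n} i = trans (cong (_+ suc (toℕ i)) (opposite-prop i)) (m∸n+n≡m (toℕ<n i))

upperRow lowerRow leftCol rightCol middleCol : ℕ → ℕ → Bool
upperRow  k i = i <ᵇ k
lowerRow  k i = k <ᵇ suc i
leftCol   l j = j <ᵇ l
rightCol  l j = l <ᵇ j
middleCol l j = j ≡ᵇ l

upperRow-opposite : ∀ {k} (i : Fin (2 * k)) → upperRow k (toℕ (opposite i)) ≡ lowerRow k (toℕ i)
upperRow-opposite {k} i = <ᵇ-swap (toℕ (opposite i)) (suc (toℕ i)) k k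
  (trans (toℕ-opposite-+-suc i) (cong (k +_) (+-identityʳ k)))

lowerRow-opposite : ∀ {k} (i : Fin (2 * k)) → lowerRow k (toℕ (opposite i)) ≡ upperRow k (toℕ i)
lowerRow-opposite {k} i = trans (sym (upperRow-opposite {k} (opposite i)))
                                (cong (upperRow k ∘ toℕ) (opposite-involutive i))

toℕ-opposite-+-toℕ : ∀ {l} (j : Fin (suc (2 * l))) → toℕ (opposite j) + toℕ j ≡ l + l
toℕ-opposite-+-toℕ {l} j = suc-injective (begin
  suc (toℕ (opposite j) + toℕ j) ≡⟨ +-suc (toℕ (opposite j)) (toℕ j) ⟨
  toℕ (opposite j) + suc (toℕ j) ≡⟨ toℕ-opposite-+-suc {suc (2 * l)} j ⟩
  suc (2 * l)                    ≡⟨ cong (suc ∘ (l +_)) (+-identityʳ l) ⟩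
  suc (l + l)                    ∎)
  where open ≡-Reasoning

leftCol-opposite : ∀ {l} (j : Fin (suc (2 * l))) → leftCol l (toℕ (opposite j)) ≡ rightCol l (toℕ j)
leftCol-opposite {l} j = <ᵇ-swap (toℕ (opposite j)) (toℕ j) l l (toℕ-opposite-+-toℕ {l} j)

rightCol-opposite : ∀ {l} (j : Fin (suc (2 * l))) → rightCol l (toℕ (opposite j)) ≡ leftCol l (toℕ j)
rightCol-opposite {l} j = trans (sym (leftCol-opposite {l} (opposite j)))
                                (cong (leftCol l ∘ toℕ) (opposite-involutive j))

middleCol-opposite : ∀ {l} (j : Fin (suc (2 * l))) → middleCol l (toℕ (opposite j)) ≡ middleCol l (toℕ j)
middleCol-opposite {l} j = ≡ᵇ-swap (toℕ (opposite j)) (toℕ j) l l (toℕ-opposite-+-toℕ {l} j)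

countIn-act-H : ∀ {k l} (b : Board k l) (R R′ C : ℕ → Bool) →
                (∀ (i : Fin (2 * k)) → R (toℕ (opposite i)) ≡ R′ (toℕ i)) →
                countIn (act H b) (λ i j → R i ∧ C j) ≡ countIn b (λ i j → R′ i ∧ C j)
countIn-act-H {k} {l} b R R′ C R∘opposite = trans (sum-allFin-opposite (2 * k) _)
  (sum-allFin-cong (2 * k) λ i → sum-allFin-cong (suc (2 * l)) λ j →
    cong₂ (λ i′ r → if cell b i′ j ∧ (r ∧ C (toℕ j)) then 1 else 0)
          (opposite-involutive i) (R∘opposite i))

countIn-act-V : ∀ {k l} (b : Board k l) (R C C′ : ℕ → Bool) →
                (∀ (j : Fin (suc (2 * l))) → C (toℕ (opposite j)) ≡ C′ (toℕ j)) →
                countIn (act V b) (λ i j → R i ∧ C j) ≡ countIn b (λ i j → R i ∧ C′ j)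
countIn-act-V {k} {l} b R C C′ C∘opposite =
  sum-allFin-cong (2 * k) λ i → trans (sum-allFin-opposite (suc (2 * l)) _)
  (sum-allFin-cong (suc (2 * l)) λ j →
    cong₂ (λ j′ c → if cell b i j′ ∧ (R (toℕ i) ∧ c) then 1 else 0)
          (opposite-involutive j) (C∘opposite j))

countIn-cong : ∀ {k l} {b b′ : Board k l} (P : ℕ → ℕ → Bool) →
               (∀ i j → cell b i j ≡ cell b′ i j) → countIn b P ≡ countIn b′ P
countIn-cong {k} {l} P b≗b′ = sum-allFin-cong (2 * k) λ i → sum-allFin-cong (suc (2 * l)) λ j →
  cong (λ c → if c ∧ P (toℕ i) (toℕ j) then 1 else 0) (b≗b′ i j)

countIn-≤-blocked : ∀ {k l} (b : Board k l) (P : ℕ → ℕ → Bool) → countIn b P ≤ blocked b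
countIn-≤-blocked {k} {l} b P =
  sum-map-mono-≤ (allFin (2 * k)) λ i → sum-map-mono-≤ (allFin (suc (2 * l))) λ j →
    ∧-count-≤ (cell b i j) (P (toℕ i) (toℕ j))
  where
  ∧-count-≤ : ∀ c q → (if c ∧ q then 1 else 0) ≤ (if c ∧ true then 1 else 0)
  ∧-count-≤ false q     = z≤n
  ∧-count-≤ true  false = z≤n
  ∧-count-≤ true  true  = ≤-refl

pact : Sym → Partition → Partition
pact R0   p                        = p
pact H    (part a₁ a₂ a₃ a₄ d₁ d₂) = part a₄ a₃ a₂ a₁ d₂ d₁
pact V    (part a₁ a₂ a₃ a₄ d₁ d₂) = part a₂ a₁ a₄ a₃ d₁ d₂
pact R180 (part a₁ a₂ a₃ a₄ d₁ d₂) = part a₃ a₄ a₁ a₂ d₂ d₁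

part-cong : ∀ {a₁ a₂ a₃ a₄ d₁ d₂ a₁′ a₂′ a₃′ a₄′ d₁′ d₂′} →
            a₁ ≡ a₁′ → a₂ ≡ a₂′ → a₃ ≡ a₃′ → a₄ ≡ a₄′ → d₁ ≡ d₁′ → d₂ ≡ d₂′ →
            part a₁ a₂ a₃ a₄ d₁ d₂ ≡ part a₁′ a₂′ a₃′ a₄′ d₁′ d₂′
part-cong refl refl refl refl refl refl = refl

key : Partition → List ℕ
key (part a₁ a₂ a₃ a₄ d₁ d₂) = a₁ ∷ a₂ ∷ a₃ ∷ a₄ ∷ d₁ ∷ d₂ ∷ []

key-injective : ∀ {p q} → key p ≡ key q → p ≡ q
key-injective refl = refl

-- key (partitionOf b) is definitionally map (countIn b) (regions k l).
regions : ℕ → ℕ → List (ℕ → ℕ → Bool)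
regions k l =
  (λ i j → upperRow k i ∧ leftCol l j)   ∷ (λ i j → upperRow k i ∧ rightCol l j) ∷
  (λ i j → lowerRow k i ∧ rightCol l j)  ∷ (λ i j → lowerRow k i ∧ leftCol l j)  ∷
  (λ i j → upperRow k i ∧ middleCol l j) ∷ (λ i j → lowerRow k i ∧ middleCol l j) ∷ []

partitionOf-cong : ∀ {k l} {b b′ : Board k l} → (∀ i j → cell b i j ≡ cell b′ i j) →
                   partitionOf b ≡ partitionOf b′
partitionOf-cong {k} {l} b≗b′ =
  key-injective (map-cong (λ P → countIn-cong {k} {l} P b≗b′) (regions k l))

partitionOf-≤-blocked : ∀ {k l} (b : Board k l) → All (_≤ blocked b) (key (partitionOf b))
partitionOf-≤-blocked {k} {l} b = map⁺ (universal (countIn-≤-blocked b) (regions k l))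

partitionOf-act-H : ∀ {k l} (b : Board k l) → partitionOf (act H b) ≡ pact H (partitionOf b)
partitionOf-act-H {k} {l} b = part-cong
  (countIn-act-H b (upperRow k) (lowerRow k) (leftCol l)   (upperRow-opposite {k}))
  (countIn-act-H b (upperRow k) (lowerRow k) (rightCol l)  (upperRow-opposite {k}))
  (countIn-act-H b (lowerRow k) (upperRow k) (rightCol l)  (lowerRow-opposite {k}))
  (countIn-act-H b (lowerRow k) (upperRow k) (leftCol l)   (lowerRow-opposite {k}))
  (countIn-act-H b (upperRow k) (lowerRow k) (middleCol l) (upperRow-opposite {k}))
  (countIn-act-H b (lowerRow k) (upperRow k) (middleCol l) (lowerRow-opposite {k}))

partitionOf-act-V : ∀ {k l} (b : Board k l) → partitionOf (act V b) ≡ pact V (partitionOf b)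
partitionOf-act-V {k} {l} b = part-cong
  (countIn-act-V b (upperRow k) (leftCol l)   (rightCol l)  (leftCol-opposite {l}))
  (countIn-act-V b (upperRow k) (rightCol l)  (leftCol l)   (rightCol-opposite {l}))
  (countIn-act-V b (lowerRow k) (rightCol l)  (leftCol l)   (rightCol-opposite {l}))
  (countIn-act-V b (lowerRow k) (leftCol l)   (rightCol l)  (leftCol-opposite {l}))
  (countIn-act-V b (upperRow k) (middleCol l) (middleCol l) (middleCol-opposite {l}))
  (countIn-act-V b (lowerRow k) (middleCol l) (middleCol l) (middleCol-opposite {l}))

partitionOf-act : ∀ {k l} g (b : Board k l) → partitionOf (act g b) ≡ pact g (partitionOf b)
partitionOf-act R0   b = refl
partitionOf-act H    b = partitionOf-act-H b
partitionOf-act V    b = partitionOf-act-V b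
partitionOf-act R180 b = trans (partitionOf-act-V (act H b)) (cong (pact V) (partitionOf-act-H b))

blocked-act : ∀ {k l} g (b : Board k l) → blocked (act g b) ≡ blocked b
blocked-act R0   b = refl
blocked-act H    b = countIn-act-H b (const true) (const true) (const true) λ _ → refl
blocked-act V    b = countIn-act-V b (const true) (const true) (const true) λ _ → refl
blocked-act R180 b = trans (blocked-act V (act H b)) (blocked-act H b)

_∙_ : Sym → Sym → Sym
R0   ∙ g    = g
g    ∙ R0   = g
H    ∙ H    = R0
H    ∙ V    = R180
H    ∙ R180 = V
V    ∙ H    = R180
V    ∙ V    = R0
V    ∙ R180 = H
R180 ∙ H    = V
R180 ∙ V    = H
R180 ∙ R180 = R0

pact-∙ : ∀ g h p → pact g (pact h p) ≡ pact (g ∙ h) p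
pact-∙ R0   h    p = refl
pact-∙ H    R0   p = refl
pact-∙ H    H    p = refl
pact-∙ H    V    p = refl
pact-∙ H    R180 p = refl
pact-∙ V    R0   p = refl
pact-∙ V    H    p = refl
pact-∙ V    V    p = refl
pact-∙ V    R180 p = refl
pact-∙ R180 R0   p = refl
pact-∙ R180 H    p = refl
pact-∙ R180 V    p = refl
pact-∙ R180 R180 p = refl

pact-involutive : ∀ g p → pact g (pact g p) ≡ p
pact-involutive R0   p = refl
pact-involutive H    p = refl
pact-involutive V    p = refl
pact-involutive R180 p = refl

allSym : List Sym
allSym = R0 ∷ H ∷ V ∷ R180 ∷ []

∈-allSym : ∀ g → g ∈ allSym
∈-allSym R0   = here refl
∈-allSym H    = there (here refl)
∈-allSym V    = there (there (here refl))
∈-allSym R180 = there (there (there (here refl)))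

lexOrder : DecTotalOrder _ _ _
lexOrder = Lex.≤-decTotalOrder ≤-decTotalOrder

open DecTotalOrder lexOrder
  using (totalOrder) renaming (_≤_ to _≤ₗ_; refl to ≤ₗ-refl; antisym to ≤ₗ-antisym)
open import Data.List.Extrema totalOrder using (argmax; f[xs]≤f[argmax])

∷-≤ₗ⁺ : ∀ {x y xs ys} → x ≤ y → (x ≡ y → xs ≤ₗ ys) → (x ∷ xs) ≤ₗ (y ∷ ys)
∷-≤ₗ⁺ {x} {y} x≤y xs≤ys with x ≟ y
... | yes x≡y = next x≡y (xs≤ys x≡y)
... | no  x≢y = this (x≤y , x≢y)

≤ₗ-head : ∀ {x y xs ys} → (x ∷ xs) ≤ₗ (y ∷ ys) → x ≤ y
≤ₗ-head (this (x≤y , _)) = x≤y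
≤ₗ-head (next refl _)    = ≤-refl

≤ₗ-tail : ∀ {x y xs ys} → (x ∷ xs) ≤ₗ (y ∷ ys) → x ≡ y → xs ≤ₗ ys
≤ₗ-tail (this (_ , x≢y)) x≡y = contradiction x≡y x≢y
≤ₗ-tail (next _ xs≤ys)   _   = xs≤ys

Maximal : Partition → Set
Maximal p = ∀ g → key (pact g p) ≤ₗ key p

canonical⇒maximal : ∀ {p} → Canonical p → Maximal p
canonical⇒maximal _ R0 = ≤ₗ-refl
canonical⇒maximal {part a₁ a₂ a₃ a₄ d₁ d₂} ((_ , _ , a₄≤a₁) , _ , _ , c₄) H =
  ∷-≤ₗ⁺ a₄≤a₁ λ a₄≡a₁ → let (a₃≤a₂ , d₂≤d₁) = c₄ (sym a₄≡a₁) in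
  ∷-≤ₗ⁺ a₃≤a₂ λ a₃≡a₂ →
  ∷-≤ₗ⁺ (≤-reflexive (sym a₃≡a₂)) λ _ →
  ∷-≤ₗ⁺ (≤-reflexive (sym a₄≡a₁)) λ _ →
  ∷-≤ₗ⁺ (d₂≤d₁ (sym a₃≡a₂)) λ d₂≡d₁ →
  ∷-≤ₗ⁺ (≤-reflexive (sym d₂≡d₁)) λ _ → base tt
canonical⇒maximal {part a₁ a₂ a₃ a₄ d₁ d₂} ((a₂≤a₁ , _ , _) , c₂ , _ , _) V =
  ∷-≤ₗ⁺ a₂≤a₁ λ a₂≡a₁ →
  ∷-≤ₗ⁺ (≤-reflexive (sym a₂≡a₁)) λ _ →
  ∷-≤ₗ⁺ (c₂ (sym a₂≡a₁)) λ a₄≡a₃ →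
  ∷-≤ₗ⁺ (≤-reflexive (sym a₄≡a₃)) λ _ → ≤ₗ-refl
canonical⇒maximal {part a₁ a₂ a₃ a₄ d₁ d₂} ((_ , a₃≤a₁ , _) , _ , c₃ , _) R180 =
  ∷-≤ₗ⁺ a₃≤a₁ λ a₃≡a₁ → let (a₄≤a₂ , d₂≤d₁) = c₃ (sym a₃≡a₁) in
  ∷-≤ₗ⁺ a₄≤a₂ λ a₄≡a₂ →
  ∷-≤ₗ⁺ (≤-reflexive (sym a₃≡a₁)) λ _ →
  ∷-≤ₗ⁺ (≤-reflexive (sym a₄≡a₂)) λ _ →
  ∷-≤ₗ⁺ (d₂≤d₁ (sym a₄≡a₂)) λ d₂≡d₁ →
  ∷-≤ₗ⁺ (≤-reflexive (sym d₂≡d₁)) λ _ → base tt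

maximal⇒canonical : ∀ {p} → Maximal p → Canonical p
maximal⇒canonical {part a₁ a₂ a₃ a₄ d₁ d₂} max =
  (≤ₗ-head (max V) , ≤ₗ-head (max R180) , ≤ₗ-head (max H)) , c₂ , c₃ , c₄
  where
  c₂ : a₁ ≡ a₂ → a₄ ≤ a₃
  c₂ a₁≡a₂ = ≤ₗ-head (≤ₗ-tail (≤ₗ-tail (max V) (sym a₁≡a₂)) a₁≡a₂)

  c₃ : a₁ ≡ a₃ → a₄ ≤ a₂ × (a₂ ≡ a₄ → d₂ ≤ d₁)
  c₃ a₁≡a₃ = ≤ₗ-head rest , λ a₂≡a₄ →
    ≤ₗ-head (≤ₗ-tail (≤ₗ-tail (≤ₗ-tail rest (sym a₂≡a₄)) a₁≡a₃) a₂≡a₄)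
    where rest = ≤ₗ-tail (max R180) (sym a₁≡a₃)

  c₄ : a₁ ≡ a₄ → a₃ ≤ a₂ × (a₂ ≡ a₃ → d₂ ≤ d₁)
  c₄ a₁≡a₄ = ≤ₗ-head rest , λ a₂≡a₃ →
    ≤ₗ-head (≤ₗ-tail (≤ₗ-tail (≤ₗ-tail rest (sym a₂≡a₃)) a₂≡a₃) a₁≡a₄)
    where rest = ≤ₗ-tail (max H) (sym a₁≡a₄)

maximal-unique : ∀ g {p} → Maximal p → Maximal (pact g p) → pact g p ≡ p
maximal-unique g {p} max-p max-gp = key-injective (Pointwise-≡⇒≡ (≤ₗ-antisym (max-p g)
  (subst (λ q → key q ≤ₗ key (pact g p)) (pact-involutive g p) (max-gp g))))

orbit-bound⇒maximal : ∀ p g₀ → (∀ g → key (pact g p) ≤ₗ key (pact g₀ p)) → Maximal (pact g₀ p)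
orbit-bound⇒maximal p g₀ ≤g₀ g =
  subst (λ q → key q ≤ₗ key (pact g₀ p)) (sym (pact-∙ g g₀ p)) (≤g₀ (g ∙ g₀))

argmax-exists : ∀ {A : Set} (f : A → List ℕ) x₀ xs → (∀ x → x ∈ xs) → ∃ λ m → ∀ x → f x ≤ₗ f m
argmax-exists f x₀ xs complete = argmax f x₀ xs , λ x → lookup (f[xs]≤f[argmax] x₀ xs) (complete x)

maximal-in-orbit : ∀ p → ∃ λ g → Maximal (pact g p)
maximal-in-orbit p =
  let (g₀ , ≤g₀) = argmax-exists (λ g → key (pact g p)) R0 allSym ∈-allSym
  in g₀ , orbit-bound⇒maximal p g₀ ≤g₀

canonical? : ∀ p → Dec (Canonical p)
canonical? (part a₁ a₂ a₃ a₄ d₁ d₂) =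
  ((a₂ ≤? a₁) ×-dec (a₃ ≤? a₁) ×-dec (a₄ ≤? a₁))
  ×-dec ((a₁ ≟ a₂) →-dec (a₄ ≤? a₃))
  ×-dec ((a₁ ≟ a₃) →-dec ((a₄ ≤? a₂) ×-dec ((a₂ ≟ a₄) →-dec (d₂ ≤? d₁))))
  ×-dec ((a₁ ≟ a₄) →-dec ((a₃ ≤? a₂) ×-dec ((a₂ ≟ a₃) →-dec (d₂ ≤? d₁))))

partitionsUpTo : ℕ → List Partition
partitionsUpTo r = map fromTuple (ns ⊗ ns ⊗ ns ⊗ ns ⊗ ns ⊗ ns)
  where
  ns : List ℕ
  ns = upTo (suc r)

  infixr 5 _⊗_
  _⊗_ : ∀ {A B : Set} → List A → List B → List (A × B)
  _⊗_ = cartesianProduct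

  fromTuple : ℕ × ℕ × ℕ × ℕ × ℕ × ℕ → Partition
  fromTuple (a₁ , a₂ , a₃ , a₄ , d₁ , d₂) = part a₁ a₂ a₃ a₄ d₁ d₂

∈-partitionsUpTo : ∀ {r p} → All (_≤ r) (key p) → p ∈ partitionsUpTo r
∈-partitionsUpTo {r} (a₁≤r ∷ a₂≤r ∷ a₃≤r ∷ a₄≤r ∷ d₁≤r ∷ d₂≤r ∷ []) =
  ∈-map⁺ _ (∈ns a₁≤r ⊗⁺ ∈ns a₂≤r ⊗⁺ ∈ns a₃≤r ⊗⁺ ∈ns a₄≤r ⊗⁺ ∈ns d₁≤r ⊗⁺ ∈ns d₂≤r)
  where
  ∈ns : ∀ {a} → a ≤ r → a ∈ upTo (suc r)
  ∈ns a≤r = ∈-upTo⁺ (s≤s a≤r)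

  infixr 5 _⊗⁺_
  _⊗⁺_ : ∀ {A B : Set} {x : A} {y : B} {xs ys} → x ∈ xs → y ∈ ys → (x , y) ∈ cartesianProduct xs ys
  _⊗⁺_ = ∈-cartesianProduct⁺

canonicalPartitions : ℕ → List Partition
canonicalPartitions r = filter canonical? (partitionsUpTo r)

InBbar⇔∈-canonicalPartitions : ∀ {k l r} (b : Board k l) → InB r b →
                               InBbar r b ⇔ partitionOf b ∈ canonicalPartitions r
InBbar⇔∈-canonicalPartitions {r = r} b refl = mk⇔
  (λ (_ , c) → ∈-filter⁺ canonical? (∈-partitionsUpTo (partitionOf-≤-blocked b)) c)
  (λ ∈filter → refl , proj₂ (∈-filter⁻ canonical? {xs = partitionsUpTo r} ∈filter))

canonical-image : ∀ {k l r} (b : Board k l) → InB r b → ∃ λ b′ → InBbar r b′ × Equiv b b′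
canonical-image b inB =
  let (g , max) = maximal-in-orbit (partitionOf b) in
  act g b ,
  (trans (blocked-act g b) inB , subst Canonical (sym (partitionOf-act g b)) (maximal⇒canonical max)) ,
  g , λ _ _ → refl

canonical-equivalent⇒same-partition : ∀ {k l r} (b b′ : Board k l) → InBbar r b → InBbar r b′ →
                                      Equiv b b′ → partitionOf b ≡ partitionOf b′
canonical-equivalent⇒same-partition {k} {l} b b′ (_ , c) (_ , c′) (g , gb≗b′) =
  sym (trans b′≡gb (maximal-unique g (canonical⇒maximal c)
                      (canonical⇒maximal (subst Canonical b′≡gb c′))))
  where
  b′≡gb : partitionOf b′ ≡ pact g (partitionOf b)
  b′≡gb = trans (sym (partitionOf-cong {k} {l} gb≗b′)) (partitionOf-act g b)

theorem4p9 : (k l r : ℕ) → 1 ≤ k → 1 ≤ l → 1 ≤ r → r ≤ (2 * k) * (suc (2 * l)) →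
    (Σ (List Partition) λ L →
        ∀ (b : Board k l) → InB r b → (InBbar r b ⇔ partitionOf b ∈ L))
    × (∀ (b : Board k l) → InB r b → ∃ λ (b' : Board k l) → InBbar r b' × Equiv b b')
    × (∀ (b b' : Board k l) → InBbar r b → InBbar r b' → Equiv b b' → partitionOf b ≡ partitionOf b')
theorem4p9 k l r _ _ _ _ =
  (canonicalPartitions r , InBbar⇔∈-canonicalPartitions) ,
  canonical-image ,
  canonical-equivalent⇒same-partition
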